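{- An algebra $\mathbf A=(A;\wedge,d)$ (of arbitrary cardinality) with binary $\wedge$ and ternary $d$ is a regular SMB algebra (over some congruence) if and only if it satisfies the following identities: $x\wedge x\approx x$; $d(x,x,x)\approx x$; $(x\wedge y)\wedge(y\wedge x)\approx y\wedge x$; $(x\wedge(y\wedge z))\wedge((x\wedge y)\wedge z)\approx (x\wedge y)\wedge z$; $((x\wedge y)\wedge z)\wedge(x\wedge(y\wedge z))\approx x\wedge(y\wedge z)$; $d(x\wedge y,y\wedge x,y\wedge x)\approx d(y\wedge x,y\wedge x,x\wedge y)\approx x\wedge y$; $((x\wedge y)\wedge z)\wedge d(x,y,z)\approx d(x,y,z)$; $d(x,y,z)\wedge((x\wedge y)\wedge z)\approx (x\wedge y)\wedge z$; $x\wedge(x\wedge y)\approx x\wedge y$; $x\wedge(y\wedge x)\approx y\wedge x$; $d(x,y,z)\approx d((y\wedge z)\wedge x,(x\wedge z)\wedge y,(x\wedge y)\wedge z)$; $(x\wedge y)\wedge y\approx x\wedge y$. In particular, these identities form an equational base for the variety of regular SMB algebras.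
   Context: An algebra $\mathbf A=(A;\wedge,d)$ is idempotent if $x\wedge x=x$ and $d(x,x,x)=x$ for all $x$. For a congruence ${\sim}$ of $\mathbf A$, $\mathbf A$ is an SMB algebra over ${\sim}$ if it is idempotent, $(A/{\sim};\wedge)$ is a semilattice, and on each ${\sim}$-class $\wedge$ acts as the second projection and $d$ acts as a Mal'cev operation ($d(x,y,y)=x=d(y,y,x)$). Write $[u]_{\sim}\le[v]_{\sim}$ iff $[u]_{\sim}\wedge[v]_{\sim}=[u]_{\sim}$. An SMB algebra $\mathbf A$ over ${\sim}$ is regular if (i) $[d(a,b,c)]_{\sim}=[(a\wedge b)\wedge c]_{\sim}$ for all $a,b,c\in A$; (ii) $a\wedge b=b$ whenever $[a]_{\sim}\ge[b]_{\sim}$; (iii) $\mathbf A\models d(x,y,z)\approx d((y\wedge z)\wedge x,(x\wedge z)\wedge y,(x\wedge y)\wedge z)$; (iv) $\mathbf A\models (x\wedge y)\wedge y\approx x\wedge y$. An algebra is a regular SMB algebra if it is a regular SMB algebra over some congruence. -}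

module Defs where

open import Level using (Level; suc)
open import Data.Product using (Σ; _×_)
open import Relation.Binary.PropositionalEquality using (_≡_)
open import Relation.Binary.Structures using (IsEquivalence)

module _ {a : Level} {A : Set a} (_∧_ : A → A → A) (d : A → A → A → A) where

  record IsCongruence (_~_ : A → A → Set a) : Set a where
    field
      isEquivalence : IsEquivalence _~_
      ∧-cong : ∀ {x x′ y y′} → x ~ x′ → y ~ y′ → (x ∧ y) ~ (x′ ∧ y′)
      d-cong : ∀ {x x′ y y′ z z′} → x ~ x′ → y ~ y′ → z ~ z′ → d x y z ~ d x′ y′ z′

  record IsSMBOver (_~_ : A → A → Set a) : Set a where
    field
      isCongruence : IsCongruence _~_
      ∧-idem : ∀ x → (x ∧ x) ≡ x
      d-idem : ∀ x → d x x x ≡ x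
      -- (A/~ ; ∧) is a semilattice (written out on representatives)
      quot-assoc : ∀ x y z → ((x ∧ y) ∧ z) ~ (x ∧ (y ∧ z))
      quot-comm  : ∀ x y → (x ∧ y) ~ (y ∧ x)
      quot-idem  : ∀ x → (x ∧ x) ~ x
      class-proj₂ : ∀ {x y} → x ~ y → (x ∧ y) ≡ y
      class-malcev₁ : ∀ {x y} → x ~ y → d x y y ≡ x
      class-malcev₂ : ∀ {x y} → x ~ y → d y y x ≡ x

  -- [u] ≤ [v] in A/~  iff  [u] ∧ [v] = [u]
  _≤[_]_ : A → (A → A → Set a) → A → Set a
  u ≤[ _~_ ] v = (u ∧ v) ~ u

  record IsRegularSMBOver (_~_ : A → A → Set a) : Set a where
    field
      isSMB : IsSMBOver _~_
      reg-i : ∀ x y z → d x y z ~ ((x ∧ y) ∧ z)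
      reg-ii : ∀ {x y} → y ≤[ _~_ ] x → (x ∧ y) ≡ y
      reg-iii : ∀ x y z → d x y z ≡ d ((y ∧ z) ∧ x) ((x ∧ z) ∧ y) ((x ∧ y) ∧ z)
      reg-iv : ∀ x y → ((x ∧ y) ∧ y) ≡ (x ∧ y)

  IsRegularSMB : Set (suc a)
  IsRegularSMB = Σ (A → A → Set a) IsRegularSMBOver

  record SatisfiesIdentities : Set a where
    field
      id1  : ∀ x → (x ∧ x) ≡ x
      id2  : ∀ x → d x x x ≡ x
      id3  : ∀ x y → ((x ∧ y) ∧ (y ∧ x)) ≡ (y ∧ x)
      id4  : ∀ x y z → ((x ∧ (y ∧ z)) ∧ ((x ∧ y) ∧ z)) ≡ ((x ∧ y) ∧ z)
      id5  : ∀ x y z → (((x ∧ y) ∧ z) ∧ (x ∧ (y ∧ z))) ≡ (x ∧ (y ∧ z))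
      id6a : ∀ x y → d (x ∧ y) (y ∧ x) (y ∧ x) ≡ (x ∧ y)
      id6b : ∀ x y → d (y ∧ x) (y ∧ x) (x ∧ y) ≡ (x ∧ y)
      id7  : ∀ x y z → (((x ∧ y) ∧ z) ∧ d x y z) ≡ d x y z
      id8  : ∀ x y z → (d x y z ∧ ((x ∧ y) ∧ z)) ≡ ((x ∧ y) ∧ z)
      id9  : ∀ x y → (x ∧ (x ∧ y)) ≡ (x ∧ y)
      id10 : ∀ x y → (x ∧ (y ∧ x)) ≡ (y ∧ x)
      id11 : ∀ x y z → d x y z ≡ d ((y ∧ z) ∧ x) ((x ∧ z) ∧ y) ((x ∧ y) ∧ z)
      id12 : ∀ x y → ((x ∧ y) ∧ y) ≡ (x ∧ y)

{-# OPTIONS --safe #-}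
-- Given the identities, put x ⊒ y when x ∧ y = y. The absorption identities
-- (9), (10), (12) together with the associativity identities (4), (5) make ⊒ a
-- preorder in which x ∧ y is a greatest lower bound of x and y, so its induced
-- equivalence ~ is a congruence for ∧, and for d via d(x,y,z) ~ (x ∧ y) ∧ z,
-- which is (7)+(8). A ~-class is exactly a set on which ∧ is the second
-- projection, and (6a), (6b) then say that d is Mal'cev on it. Conversely each
-- identity is an instance of the defining properties of a regular SMB algebra.
module Submission where

open import Defs
open import Level using (Level)
open import Function.Bundles using (_⇔_; mk⇔)
open import Data.Product using (_,_; proj₁)
open import Relation.Binary.PropositionalEquality
  using (_≡_; refl; sym; trans; cong; cong₂; module ≡-Reasoning)
  renaming (isEquivalence to ≡-isEquivalence)
open import Relation.Binary.Bundles using (Preorder; Setoid)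
open import Relation.Binary.Structures using (IsEquivalence; IsPreorder)
import Relation.Binary.Properties.Preorder as PreorderProperties

module RegularSMBOver {a : Level} {A : Set a} {_∧_ : A → A → A} {d : A → A → A → A}
                      {_~_ : A → A → Set a} (R : IsRegularSMBOver _∧_ d _~_) where
  open IsRegularSMBOver R
  open IsSMBOver isSMB
  open IsCongruence isCongruence
  open IsEquivalence isEquivalence using () renaming (refl to ~-refl; sym to ~-sym; trans to ~-trans)

  [x∧y]∧x~x∧y : ∀ x y → ((x ∧ y) ∧ x) ~ (x ∧ y)
  [x∧y]∧x~x∧y x y =
    ~-trans (quot-assoc x y x)
    (~-trans (∧-cong ~-refl (quot-comm y x))
    (~-trans (~-sym (quot-assoc x x y)) (∧-cong (quot-idem x) ~-refl)))

  [x∧y]∧y~x∧y : ∀ x y → ((x ∧ y) ∧ y) ~ (x ∧ y)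
  [x∧y]∧y~x∧y x y rewrite reg-iv x y = ~-refl

  identities : SatisfiesIdentities _∧_ d
  identities = record
    { id1  = ∧-idem
    ; id2  = d-idem
    ; id3  = λ x y → class-proj₂ (quot-comm x y)
    ; id4  = λ x y z → class-proj₂ (~-sym (quot-assoc x y z))
    ; id5  = λ x y z → class-proj₂ (quot-assoc x y z)
    ; id6a = λ x y → class-malcev₁ (quot-comm x y)
    ; id6b = λ x y → class-malcev₂ (quot-comm x y)
    ; id7  = λ x y z → class-proj₂ (~-sym (reg-i x y z))
    ; id8  = λ x y z → class-proj₂ (reg-i x y z)
    ; id9  = λ x y → reg-ii ([x∧y]∧x~x∧y x y)
    ; id10 = λ x y → reg-ii ([x∧y]∧y~x∧y y x)
    ; id11 = reg-iii
    ; id12 = reg-iv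
    }

module Identities {a : Level} {A : Set a} {_∧_ : A → A → A} {d : A → A → A → A}
                  (S : SatisfiesIdentities _∧_ d) where
  open SatisfiesIdentities S
  open ≡-Reasoning

  _⊒_ : A → A → Set a
  x ⊒ y = (x ∧ y) ≡ y

  x⊒x∧y : ∀ x y → x ⊒ (x ∧ y)
  x⊒x∧y = id9

  y⊒x∧y : ∀ x y → y ⊒ (x ∧ y)
  y⊒x∧y x y = id10 y x

  x⊒[x∧y]∧z : ∀ x y z → x ⊒ ((x ∧ y) ∧ z)
  x⊒[x∧y]∧z x y z = begin
    x ∧ w                           ≡⟨ sym (id12 x w) ⟩
    (x ∧ w) ∧ w                     ≡⟨ cong (λ t → (x ∧ w) ∧ (t ∧ z)) (sym (id9 x y)) ⟩
    (x ∧ w) ∧ ((x ∧ (x ∧ y)) ∧ z)  ≡⟨ id4 x (x ∧ y) z ⟩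
    (x ∧ (x ∧ y)) ∧ z               ≡⟨ cong (_∧ z) (id9 x y) ⟩
    w                               ∎
    where w = (x ∧ y) ∧ z

  ⊒-trans : ∀ {x y z} → x ⊒ y → y ⊒ z → x ⊒ z
  ⊒-trans {x} {y} {z} x⊒y y⊒z = begin
    x ∧ z              ≡⟨ cong (x ∧_) (sym y⊒z) ⟩
    x ∧ (y ∧ z)        ≡⟨ cong (λ t → x ∧ (t ∧ z)) (sym x⊒y) ⟩
    x ∧ ((x ∧ y) ∧ z)  ≡⟨ x⊒[x∧y]∧z x y z ⟩
    (x ∧ y) ∧ z        ≡⟨ cong (_∧ z) x⊒y ⟩
    y ∧ z              ≡⟨ y⊒z ⟩
    z                  ∎

  ⊒-∧ : ∀ {x y z} → x ⊒ z → y ⊒ z → (x ∧ y) ⊒ z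
  ⊒-∧ {x} {y} {z} x⊒z y⊒z = begin
    (x ∧ y) ∧ z                    ≡⟨ sym (id12 (x ∧ y) z) ⟩
    ((x ∧ y) ∧ z) ∧ z              ≡⟨ cong (((x ∧ y) ∧ z) ∧_) (sym x∧[y∧z]≡z) ⟩
    ((x ∧ y) ∧ z) ∧ (x ∧ (y ∧ z))  ≡⟨ id5 x y z ⟩
    x ∧ (y ∧ z)                    ≡⟨ x∧[y∧z]≡z ⟩
    z                              ∎
    where x∧[y∧z]≡z = trans (cong (x ∧_) y⊒z) x⊒z

  ∧-mono-⊒ : ∀ {x x′ y y′} → x ⊒ x′ → y ⊒ y′ → (x ∧ y) ⊒ (x′ ∧ y′)
  ∧-mono-⊒ {x′ = x′} {y′ = y′} x⊒x′ y⊒y′ =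
    ⊒-∧ (⊒-trans x⊒x′ (x⊒x∧y x′ y′)) (⊒-trans y⊒y′ (y⊒x∧y x′ y′))

  ⊒-isPreorder : IsPreorder _≡_ _⊒_
  ⊒-isPreorder = record
    { isEquivalence = ≡-isEquivalence
    ; reflexive     = λ { {x} refl → id1 x }
    ; trans         = ⊒-trans
    }

  ⊒-preorder : Preorder a a a
  ⊒-preorder = record { isPreorder = ⊒-isPreorder }

  open PreorderProperties ⊒-preorder using (InducedEquivalence)
  open Setoid InducedEquivalence using (_≈_; isEquivalence)
    renaming (reflexive to ≈-reflexive; sym to ≈-sym; trans to ≈-trans)

  ∧-cong : ∀ {x x′ y y′} → x ≈ x′ → y ≈ y′ → (x ∧ y) ≈ (x′ ∧ y′)
  ∧-cong (x⊒x′ , x′⊒x) (y⊒y′ , y′⊒y) = ∧-mono-⊒ x⊒x′ y⊒y′ , ∧-mono-⊒ x′⊒x y′⊒y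

  d≈[x∧y]∧z : ∀ x y z → d x y z ≈ ((x ∧ y) ∧ z)
  d≈[x∧y]∧z x y z = id8 x y z , id7 x y z

  d-cong : ∀ {x x′ y y′ z z′} → x ≈ x′ → y ≈ y′ → z ≈ z′ → d x y z ≈ d x′ y′ z′
  d-cong {x} {x′} {y} {y′} {z} {z′} x≈x′ y≈y′ z≈z′ =
    ≈-trans (d≈[x∧y]∧z x y z)
    (≈-trans (∧-cong (∧-cong x≈x′ y≈y′) z≈z′) (≈-sym (d≈[x∧y]∧z x′ y′ z′)))

  d-malcevˡ : ∀ {x y} → x ≈ y → d x y y ≡ x
  d-malcevˡ {x} {y} (x∧y≡y , y∧x≡x) = begin
    d x y y                    ≡⟨ cong₂ (λ s t → d s t t) (sym y∧x≡x) (sym x∧y≡y) ⟩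
    d (y ∧ x) (x ∧ y) (x ∧ y)  ≡⟨ id6a y x ⟩
    y ∧ x                      ≡⟨ y∧x≡x ⟩
    x                          ∎

  d-malcevʳ : ∀ {x y} → x ≈ y → d y y x ≡ x
  d-malcevʳ {x} {y} (x∧y≡y , y∧x≡x) = begin
    d y y x                    ≡⟨ cong₂ (λ s t → d s s t) (sym x∧y≡y) (sym y∧x≡x) ⟩
    d (x ∧ y) (x ∧ y) (y ∧ x)  ≡⟨ id6b y x ⟩
    y ∧ x                      ≡⟨ y∧x≡x ⟩
    x                          ∎

  isSMBOver : IsSMBOver _∧_ d _≈_
  isSMBOver = record
    { isCongruence  = record { isEquivalence = isEquivalence ; ∧-cong = ∧-cong ; d-cong = d-cong }
    ; ∧-idem        = id1
    ; d-idem        = id2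
    ; quot-assoc    = λ x y z → id5 x y z , id4 x y z
    ; quot-comm     = λ x y → id3 x y , id3 y x
    ; quot-idem     = λ x → ≈-reflexive (id1 x)
    ; class-proj₂   = proj₁
    ; class-malcev₁ = d-malcevˡ
    ; class-malcev₂ = d-malcevʳ
    }

  isRegularSMBOver : IsRegularSMBOver _∧_ d _≈_
  isRegularSMBOver = record
    { isSMB   = isSMBOver
    ; reg-i   = d≈[x∧y]∧z
    ; reg-ii  = λ {x} {y} (y∧x⊒y , _) → ⊒-trans (y⊒x∧y y x) y∧x⊒y
    ; reg-iii = id11
    ; reg-iv  = id12
    }

proposition5p6 : ∀ {a : Level} {A : Set a} (_∧_ : A → A → A) (d : A → A → A → A)
                 → IsRegularSMB _∧_ d ⇔ SatisfiesIdentities _∧_ d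
proposition5p6 _∧_ d =
  mk⇔ (λ (_ , R) → RegularSMBOver.identities R)
      (λ S → _ , Identities.isRegularSMBOver S)
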